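{- Let $1\le m\le n$ be integers and let $K_{n+1}$ be the complete graph on the vertex set $\{0,1,\dots,n\}$. Let $g:\{0,1,\dots,n\}\to\mathbb{N}\cup\{\infty\}$ be a function with $g(j)=\infty$ for $j\in\{0,\dots,n-m\}$ and $g(j)\in\mathbb{N}=\{0,1,2,\dots\}$ for $j\in\{n-m+1,\dots,n\}$. Then $g$ is a $K_{n+1}$-multiparking function if and only if the sequence $\pi=(g(n-m+1)+1,\dots,g(n)+1)$ belongs to $\mathrm{PF}(m,n)$.
   Context: For a graph $G$ on vertex set $\{0,1,\dots,n\}$, a $G$-multiparking function is a function $g:\{0,\dots,n\}\to\mathbb{N}\cup\{\infty\}$ such that for every nonempty subset $U\subseteq\{0,\dots,n\}$, letting $j$ be the vertex of smallest index in $U$, either $g(j)=\infty$ or there exists a vertex $i\in U$ such that the number of edges from $i$ to vertices outside $U$ is greater than $g(i)$. For integers $0\le m\le n$, $\mathrm{PF}(m,n)$ is the set of parking functions with $m$ cars and $n$ spots: sequences $\pi=(\pi_1,\dots,\pi_m)\in\{1,\dots,n\}^m$ such that, when spots $1,\dots,n$ are initially empty and for $i=1,\dots,m$ in turn car $i$ parks in the first empty spot among $\pi_i,\pi_i+1,\dots,n$, every car succeeds in parking. -}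

module Defs where

open import Data.Nat using (ℕ; zero; suc; _+_; _∸_; _≤_; _<_; _<?_; _≟_)
open import Data.Bool using (Bool; true; false; if_then_else_)
open import Data.Fin using (Fin; toℕ)
open import Data.Fin.Subset using (Subset; _∈_; _∉_; Nonempty)
open import Data.List using (List; []; _∷_; length; map; filter; allFin)
open import Data.Nat.ListAction using (sum)
open import Data.List.Membership.DecPropositional (_≟_) using (_∈?_)
open import Data.Vec.Base using (lookup)
open import Data.Maybe using (Maybe; just; nothing)
open import Data.Product using (Σ; ∃; _×_; _,_)
open import Data.Sum using (_⊎_)
open import Relation.Binary.PropositionalEquality using (_≡_)
open import Relation.Nullary using (¬_; does)

data ℕ∞ : Set where
  fin : ℕ → ℕ∞
  ∞   : ℕ∞

_>∞_ : ℕ → ℕ∞ → Set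
k >∞ fin x = x < k
k >∞ ∞     = Data.Empty.⊥
  where import Data.Empty

-- A (multi)graph on vertex set Fin (suc n) = {0,…,n}, given by edge multiplicities.
Graph : ℕ → Set
Graph n = Fin (suc n) → Fin (suc n) → ℕ

complete : (n : ℕ) → Graph n
complete n i j = if does (toℕ i ≟ toℕ j) then 0 else 1

edgesOut : ∀ {n} → Graph n → Fin (suc n) → Subset (suc n) → ℕ
edgesOut {n} G i U =
  sum (map (G i) (filter (λ v → Data.Bool._≟_ (lookup U v) false) (allFin (suc n))))
  where import Data.Bool

IsMultiparking : ∀ {n} → Graph n → (Fin (suc n) → ℕ∞) → Set
IsMultiparking {n} G g =
  (U : Subset (suc n)) → Nonempty U →
  (j : Fin (suc n)) → j ∈ U → (∀ k → k ∈ U → toℕ j ≤ toℕ k) →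
  (g j ≡ ∞) ⊎ (Σ (Fin (suc n)) λ i → i ∈ U × (edgesOut G i U >∞ g i))

-- Parking process with spots 1,…,n.
-- First empty spot among p, p+1, …, n (search `fuel` spots starting at s).
firstFree : List ℕ → ℕ → ℕ → Maybe ℕ
firstFree occ zero    s = nothing
firstFree occ (suc k) s = if does (s ∈? occ) then firstFree occ k (suc s) else just s

parkAll : (n : ℕ) → List ℕ → List ℕ → Bool
parkAll n occ []      = true
parkAll n occ (p ∷ π) with firstFree occ (suc n ∸ p) p
... | nothing = false
... | just s  = parkAll n (s ∷ occ) π

data All≤ (n : ℕ) : List ℕ → Set where
  []  : All≤ n []
  _∷_ : ∀ {p π} → 1 ≤ p × p ≤ n → All≤ n π → All≤ n (p ∷ π)

InPF : ℕ → ℕ → List ℕ → Set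
InPF m n π = length π ≡ m × All≤ n π × parkAll n [] π ≡ true

-- value of a finite element (junk 0 at ∞; only used where g is finite)
toNat : ℕ∞ → ℕ
toNat (fin k) = k
toNat ∞       = 0

seqOf : (m n : ℕ) → (Fin (suc n) → ℕ∞) → List ℕ
seqOf m n g = map (λ j → suc (toNat (g j))) (filter (λ j → n ∸ m <? toℕ j) (allFin (suc n)))

-- Both sides are equivalent to the counting condition Fits n [] π: for every s ≤ n at most
-- n − s entries of π exceed s.  Run the
-- parking process while remembering the occupied spots: a car preferring p that parks at
-- t = p + d has driven past d occupied spots, and this run of spots pays for the counts that
-- the move from p to t raises; if it finds no spot, the spots p, …, n are all taken, which the
-- condition at s = p − 1 forbids.  Conversely the occupied spots are distinct and ≤ n, so a
-- pigeonhole count gives the condition.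
-- In K_{n+1} every vertex of U has exactly n + 1 − |U| neighbours outside U, and a set U
-- meeting {0, …, n − m} is harmless because its least vertex has g = ∞.  So g is multiparking
-- iff every nonempty U of finite vertices contains some i with g(i) < n + 1 − |U|.  Applied to
-- U = {i : g(i) ≥ s} this is the counting condition at s; conversely a set U violating it
-- would violate the counting condition at s = n + 1 − |U|.

module Submission where

open import Defs
open import Level using (Level; 0ℓ)
open import Data.Nat
open import Data.Nat.Properties
open import Data.Nat.ListAction using (sum)
open import Data.Nat.Tactic.RingSolver using (solve-∀)
open import Data.Empty using (⊥-elim)
open import Data.List using (List; []; _∷_; length; map; filter; tabulate; allFin)
open import Data.List.Properties using (length-map; length-tabulate; filter-accept; filter-reject; filter-none; filter-some)
import Data.List.Relation.Unary.All as All
open All using (All)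
open import Data.List.Relation.Unary.All.Properties using (¬Any⇒All¬)
open import Data.List.Relation.Unary.Any using (Any)
open import Data.List.Relation.Binary.Sublist.Propositional using (_⊆_; _∷ʳ_; ⊆-refl)
open import Data.List.Membership.Propositional using (lose) renaming (_∈_ to _∈ₗ_; _∉_ to _∉ₗ_)
open import Data.List.Membership.Propositional.Properties using (∈-allFin)
open import Data.List.Relation.Binary.Sublist.Propositional.Properties using (filter⁺; length-mono-≤)
open import Data.Bool using (true; false; if_then_else_)
import Data.Bool as Bool
open import Data.Maybe using (just; nothing)
open import Data.List.Membership.DecPropositional _≟_ using () renaming (_∈?_ to _∈ₗ?_)
open import Data.Fin using (Fin; zero; suc; toℕ)
open import Data.Fin.Properties using (toℕ-injective; any?)
open import Data.Product using (∃; _×_; _,_; proj₁; proj₂)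
open import Data.Sum using (inj₁; inj₂)
open import Function using (id; _∘′_)
open import Function.Bundles using (_⇔_; mk⇔; Equivalence)
open import Data.Fin.Subset using (Subset; _∈_)
open import Data.Fin.Subset.Properties using (_∈?_)
import Data.Vec.Base as Vec
open Vec using (lookup)
open import Data.Vec.Properties using (lookup∘tabulate; []=⇒lookup; lookup⇒[]=)
open import Relation.Binary.PropositionalEquality
open import Relation.Binary using (tri<; tri≈; tri>)
open import Relation.Nullary using (¬_; Dec; yes; no; does; _×-dec_; contradiction)
open import Relation.Nullary.Decidable using (dec-true; dec-false)
open import Relation.Unary using (Pred; Decidable; ∁)
  renaming (_⊆_ to _⊆ᵤ_)
open import Relation.Unary.Properties using (∁?)

private variable
  a p q : Level
  A B : Set a

m<o∸n⇒n+m<o : ∀ {m n o} → m < o ∸ n → n + m < o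
m<o∸n⇒n+m<o {m} {n} {o} m<o∸n = subst (_≤ o) (cong suc (+-comm m n)) (m≤o∸n⇒m+n≤o (suc m) n≤o m<o∸n)
  where
  n≤o : n ≤ o
  n≤o = <⇒≤ (m∸n≢0⇒n<m (λ o∸n≡0 → n≮0 (subst (m <_) o∸n≡0 m<o∸n)))

count : {P : Pred A p} → Decidable P → List A → ℕ
count P? xs = length (filter P? xs)

module _ {P : Pred A p} (P? : Decidable P) where

  count-accept : ∀ {x} xs → P x → count P? (x ∷ xs) ≡ suc (count P? xs)
  count-accept xs px = cong length (filter-accept P? px)

  count-reject : ∀ {x} xs → ¬ P x → count P? (x ∷ xs) ≡ count P? xs
  count-reject xs ¬px = cong length (filter-reject P? ¬px)

  count-none : ∀ {xs} → All (∁ P) xs → count P? xs ≡ 0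
  count-none none = cong length (filter-none P? none)

  count-pos : ∀ {xs} → Any P xs → 0 < count P? xs
  count-pos = filter-some P?

  count-∁ : ∀ xs → count P? xs + count (∁? P?) xs ≡ length xs
  count-∁ [] = refl
  count-∁ (x ∷ xs) with P? x
  ... | yes _ = cong suc (count-∁ xs)
  ... | no _  = trans (+-suc _ _) (cong suc (count-∁ xs))

  sum-map-filter-ones : (f : A → ℕ) → (∀ {x} → P x → f x ≡ 1) →
                        ∀ xs → sum (map f (filter P? xs)) ≡ count P? xs
  sum-map-filter-ones f ones [] = refl
  sum-map-filter-ones f ones (x ∷ xs) with P? x
  ... | yes px = cong₂ _+_ (ones px) (sum-map-filter-ones f ones xs)
  ... | no _   = sum-map-filter-ones f ones xs

count-mono : {P : Pred A p} {Q : Pred A q} (P? : Decidable P) (Q? : Decidable Q) →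
             P ⊆ᵤ Q → ∀ {xs ys} → xs ⊆ ys → count P? xs ≤ count Q? ys
count-mono P? Q? P⊆Q xs⊆ys = length-mono-≤ (filter⁺ P? Q? (λ { refl → P⊆Q }) xs⊆ys)

count-⊆ : {P : Pred A p} {Q : Pred A q} (P? : Decidable P) (Q? : Decidable Q) →
          P ⊆ᵤ Q → ∀ xs → count P? xs ≤ count Q? xs
count-⊆ P? Q? P⊆Q xs = count-mono P? Q? P⊆Q (⊆-refl {x = xs})

count-map-filter : {P : Pred B p} {Q : Pred A q} (P? : Decidable P) (Q? : Decidable Q) (f : A → B) →
                   ∀ xs → count P? (map f (filter Q? xs)) ≡ count (λ x → Q? x ×-dec P? (f x)) xs
count-map-filter P? Q? f [] = refl
count-map-filter P? Q? f (x ∷ xs) with Q? x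
... | no _  = count-map-filter P? Q? f xs
... | yes _ with P? (f x)
...   | yes _ = cong suc (count-map-filter P? Q? f xs)
...   | no _  = count-map-filter P? Q? f xs

count-above-tabulate : ∀ {N} c k a (h : Fin k → Fin N) → (∀ i → toℕ (h i) ≡ a + toℕ i) →
                   count (λ j → c <? toℕ j) (tabulate h) ≡ k ∸ (suc c ∸ a)
count-above-tabulate c zero    a h h≡ = sym (0∸n≡0 (suc c ∸ a))
count-above-tabulate c (suc k) a h h≡
  with rest ← count-above-tabulate c k (suc a) (h ∘′ suc) (λ i → trans (h≡ (suc i)) (+-suc a (toℕ i)))
     | h₀≡a ← trans (h≡ zero) (+-identityʳ a)
     | c <? a
... | yes c<a = begin
  count (λ j → c <? toℕ j) (h zero ∷ tabulate (h ∘′ suc))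
    ≡⟨ count-accept (λ j → c <? toℕ j) _ (subst (c <_) (sym h₀≡a) c<a) ⟩
  suc (count (λ j → c <? toℕ j) (tabulate (h ∘′ suc)))
    ≡⟨ cong suc rest ⟩
  suc (k ∸ (c ∸ a))
    ≡⟨ cong (λ x → suc (k ∸ x)) (m≤n⇒m∸n≡0 (<⇒≤ c<a)) ⟩
  suc k
    ≡⟨ cong (suc k ∸_) (m≤n⇒m∸n≡0 c<a) ⟨
  suc k ∸ (suc c ∸ a) ∎
  where open ≡-Reasoning
... | no c≮a = begin
  count (λ j → c <? toℕ j) (h zero ∷ tabulate (h ∘′ suc))
    ≡⟨ count-reject (λ j → c <? toℕ j) _ (subst (λ x → ¬ c < x) (sym h₀≡a) c≮a) ⟩
  count (λ j → c <? toℕ j) (tabulate (h ∘′ suc))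
    ≡⟨ rest ⟩
  k ∸ (c ∸ a)
    ≡⟨ cong (suc k ∸_) (+-∸-assoc 1 (≮⇒≥ c≮a)) ⟨
  suc k ∸ (suc c ∸ a) ∎
  where open ≡-Reasoning

#≥ : ℕ → List ℕ → ℕ
#≥ b = count (b ≤?_)

#≡ : ℕ → List ℕ → ℕ
#≡ b = count (b ≟_)

#≥-accept : ∀ {b x} xs → b ≤ x → #≥ b (x ∷ xs) ≡ suc (#≥ b xs)
#≥-accept {b} = count-accept (b ≤?_)

#≥-reject : ∀ {b x} xs → x < b → #≥ b (x ∷ xs) ≡ #≥ b xs
#≥-reject {b} xs x<b = count-reject (b ≤?_) xs (<⇒≱ x<b)

#≥-antitone : ∀ {a b} xs → a ≤ b → #≥ b xs ≤ #≥ a xs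
#≥-antitone {a} {b} xs a≤b = count-⊆ (b ≤?_) (a ≤?_) (≤-trans a≤b) xs

#≥-∷ : ∀ {b} x xs → #≥ b xs ≤ #≥ b (x ∷ xs)
#≥-∷ {b} x xs = count-mono (b ≤?_) (b ≤?_) id (x ∷ʳ ⊆-refl)

#≥-split : ∀ s xs → #≥ s xs ≡ #≡ s xs + #≥ (suc s) xs
#≥-split s [] = refl
#≥-split s (x ∷ xs) with <-cmp s x
... | tri< s<x s≢x _ rewrite #≥-accept xs (<⇒≤ s<x) | count-reject (s ≟_) xs s≢x
                           | #≥-accept xs s<x | #≥-split s xs = sym (+-suc _ _)
... | tri≈ _ refl _  rewrite #≥-accept xs (≤-refl {s}) | count-accept (s ≟_) xs refl
                           | #≥-reject xs (n<1+n s) | #≥-split s xs = refl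
... | tri> _ s≢x x<s rewrite #≥-reject xs x<s | count-reject (s ≟_) xs s≢x
                           | #≥-reject xs (m<n⇒m<1+n x<s) = #≥-split s xs

#≥-∈ : ∀ {s xs} → s ∈ₗ xs → suc (#≥ (suc s) xs) ≤ #≥ s xs
#≥-∈ {s} {xs} s∈xs rewrite #≥-split s xs = +-monoˡ-≤ (#≥ (suc s) xs) (count-pos (s ≟_) s∈xs)

data Occupied (occ : List ℕ) : ℕ → ℕ → Set where
  []  : ∀ {s} → Occupied occ s 0
  _∷_ : ∀ {s k} → s ∈ₗ occ → Occupied occ (suc s) k → Occupied occ s (suc k)

take-occupied : ∀ {occ s d e} → e ≤ d → Occupied occ s d → Occupied occ s e
take-occupied z≤n       _            = []
take-occupied (s≤s e≤d) (s∈occ ∷ run) = s∈occ ∷ take-occupied e≤d run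

#≥-occupied : ∀ {occ s k} → Occupied occ s k → #≥ (s + k) occ + k ≤ #≥ s occ
#≥-occupied {occ} {s} [] rewrite +-identityʳ s = ≤-reflexive (+-identityʳ _)
#≥-occupied {occ} {s} {suc k} (s∈occ ∷ run) = begin
  #≥ (s + suc k) occ + suc k   ≡⟨ cong₂ _+_ (cong (λ b → #≥ b occ) (+-suc s k)) refl ⟩
  #≥ (suc s + k) occ + suc k   ≡⟨ +-suc _ k ⟩
  suc (#≥ (suc s + k) occ + k) ≤⟨ s≤s (#≥-occupied run) ⟩
  suc (#≥ (suc s) occ)         ≤⟨ #≥-∈ s∈occ ⟩
  #≥ s occ                     ∎
  where open ≤-Reasoning

data FreeSpot (occ : List ℕ) (k s t : ℕ) : Set where
  spot : ∀ d → t ≡ s + d → d < k → t ∉ₗ occ → Occupied occ s d → FreeSpot occ k s t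

firstFree-nothing : ∀ occ k s → firstFree occ k s ≡ nothing → Occupied occ s k
firstFree-nothing occ zero    s _ = []
firstFree-nothing occ (suc k) s eq with s ∈ₗ? occ
... | yes s∈occ = s∈occ ∷ firstFree-nothing occ k (suc s) eq

firstFree-just : ∀ occ k s {t} → firstFree occ k s ≡ just t → FreeSpot occ k s t
firstFree-just occ (suc k) s eq with s ∈ₗ? occ
... | no s∉occ with refl ← eq = spot 0 (sym (+-identityʳ s)) z<s s∉occ []
... | yes s∈occ with firstFree-just occ k (suc s) eq
...   | spot d t≡ d<k t∉occ run = spot (suc d) (trans t≡ (sym (+-suc s d))) (s<s d<k) t∉occ (s∈occ ∷ run)

Fits : ℕ → List ℕ → List ℕ → Set
Fits n occ π = ∀ s → s ≤ n → #≥ (suc s) occ + #≥ (suc s) π + s ≤ n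

#≥-park-above : ∀ {s p t} occ π → s < p → p ≤ t →
                #≥ (suc s) occ + #≥ (suc s) (p ∷ π) ≡ #≥ (suc s) (t ∷ occ) + #≥ (suc s) π
#≥-park-above {s} {p} {t} occ π s<p p≤t = begin
  #≥ (suc s) occ + #≥ (suc s) (p ∷ π)  ≡⟨ cong (#≥ (suc s) occ +_) (#≥-accept π s<p) ⟩
  #≥ (suc s) occ + suc (#≥ (suc s) π)  ≡⟨ +-suc _ _ ⟩
  suc (#≥ (suc s) occ) + #≥ (suc s) π  ≡⟨ cong (_+ #≥ (suc s) π) (#≥-accept occ (<-≤-trans s<p p≤t)) ⟨
  #≥ (suc s) (t ∷ occ) + #≥ (suc s) π  ∎
  where open ≡-Reasoning

fits⇒¬occupied-to-end : ∀ {n occ q π} → q ≤ n → Fits n occ (suc q ∷ π) → ¬ Occupied occ (suc q) (n ∸ q)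
fits⇒¬occupied-to-end {n} {occ} {q} {π} q≤n fits run = 1+n≰n (begin
  suc n                                          ≡⟨ cong suc (m∸n+n≡m q≤n) ⟨
  suc (n ∸ q + q)                                ≤⟨ s≤s (+-monoˡ-≤ q (m≤m+n (n ∸ q) _)) ⟩
  suc (n ∸ q + #≥ (suc q) π + q)                 ≤⟨ s≤s (+-monoˡ-≤ q (+-monoˡ-≤ _ (m≤n+m (n ∸ q) _))) ⟩
  suc (#≥ (suc q + (n ∸ q)) occ + (n ∸ q) + #≥ (suc q) π + q)
                                                  ≤⟨ s≤s (+-monoˡ-≤ q (+-monoˡ-≤ _ (#≥-occupied run))) ⟩
  suc (#≥ (suc q) occ + #≥ (suc q) π + q)        ≡⟨ cong (_+ q) (+-suc _ _) ⟨
  #≥ (suc q) occ + suc (#≥ (suc q) π) + q        ≡⟨ cong (λ x → #≥ (suc q) occ + x + q) (#≥-accept π ≤-refl) ⟨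
  #≥ (suc q) occ + #≥ (suc q) (suc q ∷ π) + q    ≤⟨ fits q q≤n ⟩
  n                                              ∎)
  where open ≤-Reasoning

fits-within-run : ∀ {n occ q π d e} → q ≤ n → Fits n occ (suc q ∷ π) → Occupied occ (suc q) d → e ≤ d →
                  #≥ (suc q + e) (suc q + d ∷ occ) + #≥ (suc q + e) π + (q + e) ≤ n
fits-within-run {n} {occ} {q} {π} {d} {e} q≤n fits run e≤d = begin
  #≥ (suc q + e) (suc q + d ∷ occ) + #≥ (suc q + e) π + (q + e)
    ≡⟨ cong (λ x → x + #≥ (suc q + e) π + (q + e)) (#≥-accept occ (+-monoʳ-≤ (suc q) e≤d)) ⟩
  suc (#≥ (suc q + e) occ) + #≥ (suc q + e) π + (q + e)
    ≡⟨ rearrange (#≥ (suc q + e) occ) (#≥ (suc q + e) π) q e ⟩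
  #≥ (suc q + e) occ + e + suc (#≥ (suc q + e) π) + q
    ≤⟨ +-monoˡ-≤ q (+-mono-≤ (#≥-occupied (take-occupied e≤d run))
                              (s≤s (#≥-antitone π (m≤m+n (suc q) e)))) ⟩
  #≥ (suc q) occ + suc (#≥ (suc q) π) + q
    ≡⟨ cong (λ x → #≥ (suc q) occ + x + q) (#≥-accept π ≤-refl) ⟨
  #≥ (suc q) occ + #≥ (suc q) (suc q ∷ π) + q
    ≤⟨ fits q q≤n ⟩
  n ∎
  where
  open ≤-Reasoning
  rearrange : ∀ a c q e → suc a + c + (q + e) ≡ a + e + suc c + q
  rearrange = solve-∀

-- Parking at t = suc q + d only raises #≥ (suc s) for q ≤ s < t.
fits-after-parking : ∀ {n occ q π d} → Fits n occ (suc q ∷ π) → Occupied occ (suc q) d →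
                     Fits n (suc q + d ∷ occ) π
fits-after-parking {n} {occ} {q} {π} {d} fits run s s≤n with s <? suc q | s <? suc q + d
... | yes s<p | _ = begin
  #≥ (suc s) (suc q + d ∷ occ) + #≥ (suc s) π + s ≡⟨ cong (_+ s) (#≥-park-above occ π s<p (m≤m+n _ d)) ⟨
  #≥ (suc s) occ + #≥ (suc s) (suc q ∷ π) + s     ≤⟨ fits s s≤n ⟩
  n                                               ∎
  where open ≤-Reasoning
... | no s≮p | no s≮t
  rewrite #≥-reject occ (s≤s (≮⇒≥ s≮t)) | sym (#≥-reject π (s≤s (≮⇒≥ s≮p))) = fits s s≤n
... | no s≮p | yes s<t =
  subst (λ s → #≥ (suc s) (suc q + d ∷ occ) + #≥ (suc s) π + s ≤ n) (m+[n∸m]≡n q≤s)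
        (fits-within-run (≤-trans q≤s s≤n) fits run e≤d)
  where
  q≤s = <⇒≤ (≮⇒≥ s≮p)
  e≤d = s≤s⁻¹ (m<n+o⇒m∸n<o s q (subst (s <_) (sym (+-suc q d)) s<t))

fits⇒parks : ∀ n occ π → All≤ n π → Fits n occ π → parkAll n occ π ≡ true
fits⇒parks n occ []          _                    _    = refl
fits⇒parks n occ (suc q ∷ π) ((_ , p≤n) ∷ bounded) fits with firstFree occ (suc n ∸ suc q) (suc q) in eq
... | nothing = ⊥-elim (fits⇒¬occupied-to-end (<⇒≤ p≤n) fits (firstFree-nothing occ _ _ eq))
... | just t with firstFree-just occ (n ∸ q) (suc q) eq
...   | spot d refl _ _ run = fits⇒parks n (suc q + d ∷ occ) π bounded (fits-after-parking fits run)

DistinctSpots : ℕ → List ℕ → Set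
DistinctSpots n occ = (∀ s → #≡ s occ ≤ 1) × #≥ (suc n) occ ≡ 0

#≥-distinct : ∀ {n occ s} → DistinctSpots n occ → s ≤ n → #≥ (suc s) occ + s ≤ n
#≥-distinct {n} {occ} {s} (atMostOnce , noneAbove) s≤n = descend (n ∸ s) _ (m+[n∸m]≡n s≤n)
  where
  descend : ∀ k s → s + k ≡ n → #≥ (suc s) occ + s ≤ n
  descend zero s refl rewrite +-identityʳ s | noneAbove = ≤-refl
  descend (suc k) s s+k≡n = begin
    #≥ (suc s) occ + s                        ≡⟨ cong (_+ s) (#≥-split (suc s) occ) ⟩
    #≡ (suc s) occ + #≥ (suc (suc s)) occ + s ≤⟨ +-monoˡ-≤ s (+-monoˡ-≤ _ (atMostOnce (suc s))) ⟩
    suc (#≥ (suc (suc s)) occ + s)            ≡⟨ +-suc _ s ⟨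
    #≥ (suc (suc s)) occ + suc s              ≤⟨ descend k (suc s) (trans (sym (+-suc s k)) s+k≡n) ⟩
    n                                         ∎
    where open ≤-Reasoning

distinct-∷ : ∀ {n occ t} → DistinctSpots n occ → t ∉ₗ occ → t ≤ n → DistinctSpots n (t ∷ occ)
distinct-∷ {n} {occ} {t} (atMostOnce , noneAbove) t∉occ t≤n =
  atMostOnce′ , trans (#≥-reject occ (s≤s t≤n)) noneAbove
  where
  atMostOnce′ : ∀ s → #≡ s (t ∷ occ) ≤ 1
  atMostOnce′ s with s ≟ t
  ... | yes refl rewrite count-accept (s ≟_) occ refl | count-none (s ≟_) (¬Any⇒All¬ occ t∉occ) = ≤-refl
  ... | no s≢t rewrite count-reject (s ≟_) occ s≢t = atMostOnce s

parks⇒fits : ∀ n occ π → DistinctSpots n occ → parkAll n occ π ≡ true → Fits n occ π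
parks⇒fits n occ [] spots _ s s≤n rewrite +-identityʳ (#≥ (suc s) occ) = #≥-distinct {occ = occ} spots s≤n
parks⇒fits n occ (p ∷ π) spots parks with firstFree occ (suc n ∸ p) p in eq
... | just t with firstFree-just occ (suc n ∸ p) p eq
...   | spot d refl d<k t∉occ _ = fits
  where
  after : Fits n (p + d ∷ occ) π
  after = parks⇒fits n (p + d ∷ occ) π (distinct-∷ spots t∉occ (s≤s⁻¹ (m<o∸n⇒n+m<o d<k))) parks
  fits : Fits n occ (p ∷ π)
  fits s s≤n with s <? p
  ... | yes s<p = begin
    #≥ (suc s) occ + #≥ (suc s) (p ∷ π) + s     ≡⟨ cong (_+ s) (#≥-park-above occ π s<p (m≤m+n p d)) ⟩
    #≥ (suc s) (p + d ∷ occ) + #≥ (suc s) π + s ≤⟨ after s s≤n ⟩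
    n                                           ∎
    where open ≤-Reasoning
  ... | no s≮p = begin
    #≥ (suc s) occ + #≥ (suc s) (p ∷ π) + s     ≡⟨ cong (λ x → #≥ (suc s) occ + x + s) (#≥-reject π (s≤s (≮⇒≥ s≮p))) ⟩
    #≥ (suc s) occ + #≥ (suc s) π + s           ≤⟨ +-monoˡ-≤ s (+-monoˡ-≤ _ (#≥-∷ (p + d) occ)) ⟩
    #≥ (suc s) (p + d ∷ occ) + #≥ (suc s) π + s ≤⟨ after s s≤n ⟩
    n                                           ∎
    where open ≤-Reasoning

#≥-none⇒All≤ : ∀ n (f : A → ℕ) xs →
               #≥ (suc n) (map (λ x → suc (f x)) xs) ≡ 0 → All≤ n (map (λ x → suc (f x)) xs)
#≥-none⇒All≤ n f []       _    = []
#≥-none⇒All≤ n f (x ∷ xs) none with suc n ≤? suc (f x)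
... | yes n≤fx with () ← trans (sym (#≥-accept (map (λ x → suc (f x)) xs) n≤fx)) none
... | no n≰fx = (s≤s z≤n , s≤s⁻¹ (≰⇒> n≰fx))
               ∷ #≥-none⇒All≤ n f xs (trans (sym (#≥-reject (map (λ x → suc (f x)) xs) (≰⇒> n≰fx))) none)

fits⇒All≤ : ∀ n (f : A → ℕ) xs →
            Fits n [] (map (λ x → suc (f x)) xs) → All≤ n (map (λ x → suc (f x)) xs)
fits⇒All≤ n f xs fits = #≥-none⇒All≤ n f xs (n≤0⇒n≡0 (+-cancelʳ-≤ n _ 0 (fits n ≤-refl)))

inPF⇔fits : ∀ m n (f : A → ℕ) xs → let π = map (λ x → suc (f x)) xs in
            InPF m n π ⇔ (length π ≡ m × Fits n [] π)
inPF⇔fits m n f xs = mk⇔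
  (λ (length≡m , _ , parks) → length≡m , parks⇒fits n [] π ((λ _ → z≤n) , refl) parks)
  (λ (length≡m , fits) → let bounded = fits⇒All≤ n f xs fits in
                         length≡m , bounded , fits⇒parks n [] π bounded fits)
  where π = map (λ x → suc (f x)) xs

least : ∀ {k} {P : Pred (Fin k) p} → Decidable P → ∃ P →
        ∃ λ j → P j × (∀ i → P i → toℕ j ≤ toℕ i)
least {k = suc k} P? (w , pw) with P? zero
... | yes p₀ = zero , p₀ , λ _ _ → z≤n
... | no ¬p₀ with w
...   | zero    = contradiction pw ¬p₀
...   | suc w′ with least (λ i → P? (suc i)) (w′ , pw)
...     | j , pj , j-least = suc j , pj , λ where
  zero    p₀ → contradiction p₀ ¬p₀
  (suc i) pi → s≤s (j-least i pi)

subsetOf : ∀ {k} {P : Pred (Fin k) p} → Decidable P → Subset k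
subsetOf P? = Vec.tabulate (λ i → does (P? i))

module _ {k} {P : Pred (Fin k) p} (P? : Decidable P) where

  ∈-subsetOf⁺ : ∀ {i} → P i → i ∈ subsetOf P?
  ∈-subsetOf⁺ {i} pi = lookup⇒[]= i _ (trans (lookup∘tabulate (λ i → does (P? i)) i) (dec-true (P? i) pi))

  ∈-subsetOf⁻ : ∀ {i} → i ∈ subsetOf P? → P i
  ∈-subsetOf⁻ {i} i∈ with P? i | trans (sym (lookup∘tabulate (λ i → does (P? i)) i)) ([]=⇒lookup i∈)
  ... | yes pi | _  = pi
  ... | no _   | ()

_>∞?_ : ∀ k x → Dec (k >∞ x)
k >∞? fin x = x <? k
k >∞? ∞     = no λ ()

>∞⇒toNat< : ∀ {k} x → k >∞ x → toNat x < k
>∞⇒toNat< (fin x) x<k = x<k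

≯∞⇒≤toNat : ∀ {k x v} → x ≡ fin v → ¬ (k >∞ x) → k ≤ toNat x
≯∞⇒≤toNat refl k≯x = ≮⇒≥ k≯x

outside? : ∀ {k} (U : Subset k) → Decidable (λ v → lookup U v ≡ false)
outside? U v = lookup U v Bool.≟ false

∈⇒¬outside : ∀ {k} {U : Subset k} {i} → i ∈ U → ¬ lookup U i ≡ false
∈⇒¬outside i∈U i∉U with () ← trans (sym ([]=⇒lookup i∈U)) i∉U

¬outside⇒∈ : ∀ {k} {U : Subset k} {i} → ¬ lookup U i ≡ false → i ∈ U
¬outside⇒∈ {U = U} {i} ¬out with lookup U i in eq
... | true  = lookup⇒[]= i U eq
... | false = contradiction refl ¬out

#in #out : ∀ {k} → Subset k → ℕ
#in  {k} U = count (∁? (outside? U)) (allFin k)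
#out {k} U = count (outside? U) (allFin k)

#in+#out : ∀ {k} (U : Subset k) → #in U + #out U ≡ k
#in+#out {k} U = trans (+-comm (#in U) _) (trans (count-∁ (outside? U) (allFin k)) (length-tabulate id))

edgesOut-complete : ∀ {n} (U : Subset (suc n)) {i} → i ∈ U → edgesOut (complete n) i U ≡ #out U
edgesOut-complete {n} U {i} i∈U = sum-map-filter-ones (outside? U) (complete n i) adjacent (allFin (suc n))
  where
  adjacent : ∀ {v} → lookup U v ≡ false → complete n i v ≡ 1
  adjacent {v} v∉U = cong (λ b → if b then 0 else 1) (dec-false (toℕ i ≟ toℕ v) i≢v)
    where
    i≢v : toℕ i ≢ toℕ v
    i≢v eq with refl ← toℕ-injective eq = ∈⇒¬outside i∈U v∉U

module _ (m n : ℕ) (g : Fin (suc n) → ℕ∞)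
         (g-∞   : ∀ j → toℕ j ≤ n ∸ m → g j ≡ ∞)
         (g-fin : ∀ j → n ∸ m < toℕ j → ∃ λ k → g j ≡ fin k) where

  -- g j ≥ s, phrased through the entry g j + 1 of seqOf so that #≥-seqOf is a plain count
  AtLeast : ℕ → Pred (Fin (suc n)) 0ℓ
  AtLeast s j = n ∸ m < toℕ j × suc s ≤ suc (toNat (g j))

  vertices : List (Fin (suc n))
  vertices = allFin (suc n)

  AtLeast? : ∀ s → Decidable (AtLeast s)
  AtLeast? s j = (n ∸ m <? toℕ j) ×-dec (suc s ≤? suc (toNat (g j)))

  #≥-seqOf : ∀ s → #≥ (suc s) (seqOf m n g) ≡ count (AtLeast? s) vertices
  #≥-seqOf s = count-map-filter (suc s ≤?_) (λ j → n ∸ m <? toℕ j) (λ j → suc (toNat (g j))) vertices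

  multiparking⇒#AtLeast : IsMultiparking (complete n) g → ∀ s → ∃ (AtLeast s) →
                          count (AtLeast? s) vertices + s ≤ n
  multiparking⇒#AtLeast mp s (w , w-heavy) using U ← subsetOf (AtLeast? s)
    with j , j∈U , j-least ← least (_∈? U) (w , ∈-subsetOf⁺ (AtLeast? s) w-heavy)
    with mp U (w , ∈-subsetOf⁺ (AtLeast? s) w-heavy) j j∈U j-least
  ... | inj₁ gj≡∞ with k , gj≡k ← g-fin j (proj₁ (∈-subsetOf⁻ (AtLeast? s) j∈U))
                  with () ← trans (sym gj≡∞) gj≡k
  ... | inj₂ (i , i∈U , out>gi) = s≤s⁻¹ (begin-strict
    count (AtLeast? s) vertices + s ≤⟨ +-monoˡ-≤ s (count-⊆ (AtLeast? s) (∁? (outside? U)) U-inside vertices) ⟩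
    #in U + s                       <⟨ +-monoʳ-< (#in U) s<out ⟩
    #in U + #out U                  ≡⟨ #in+#out U ⟩
    suc n                           ∎)
    where
    open ≤-Reasoning
    U-inside : ∀ {v} → AtLeast s v → ¬ lookup U v ≡ false
    U-inside heavy = ∈⇒¬outside (∈-subsetOf⁺ (AtLeast? s) heavy)
    s<out : s < #out U
    s<out = ≤-<-trans (s≤s⁻¹ (proj₂ (∈-subsetOf⁻ (AtLeast? s) i∈U)))
                      (subst (toNat (g i) <_) (edgesOut-complete U i∈U) (>∞⇒toNat< (g i) out>gi))

  multiparking⇒fits : IsMultiparking (complete n) g → Fits n [] (seqOf m n g)
  multiparking⇒fits mp s s≤n rewrite #≥-seqOf s with any? (AtLeast? s)
  ... | yes witness = multiparking⇒#AtLeast mp s witness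
  ... | no none rewrite count-none (AtLeast? s) (All.universal (λ j heavy → none (j , heavy)) vertices) = s≤n

  fits⇒multiparking : Fits n [] (seqOf m n g) → IsMultiparking (complete n) g
  fits⇒multiparking fits U _ j j∈U j-least with toℕ j ≤? n ∸ m
  ... | yes j-head = inj₁ (g-∞ j j-head)
  ... | no j-tail with any? (λ i → (i ∈? U) ×-dec (edgesOut (complete n) i U >∞? g i))
  ...   | yes found = inj₂ found
  ...   | no none = contradiction (begin
    suc n
      ≡⟨ #in+#out U ⟨
    #in U + #out U
      ≤⟨ +-monoˡ-≤ (#out U) (count-⊆ (∁? (outside? U)) (AtLeast? (#out U)) U-heavy vertices) ⟩
    count (AtLeast? (#out U)) vertices + #out U
      ≡⟨ cong (_+ #out U) (#≥-seqOf (#out U)) ⟨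
    #≥ (suc (#out U)) (seqOf m n g) + #out U
      ≤⟨ fits (#out U) out≤n ⟩
    n ∎) 1+n≰n
    where
    open ≤-Reasoning
    U-heavy : ∀ {i} → ¬ lookup U i ≡ false → AtLeast (#out U) i
    U-heavy {i} ¬out = i-tail , s≤s (≯∞⇒≤toNat gi≡k out≯gi)
      where
      i∈U = ¬outside⇒∈ ¬out
      i-tail = <-≤-trans (≰⇒> j-tail) (j-least i i∈U)
      gi≡k = proj₂ (g-fin i i-tail)
      out≯gi = subst (λ e → ¬ (e >∞ g i)) (edgesOut-complete U i∈U) (λ gt → none (i , i∈U , gt))
    j∈vertices = lose (∈-allFin j) (∈⇒¬outside j∈U)
    out≤n : #out U ≤ n
    out≤n = s≤s⁻¹ (begin
      suc (#out U)   ≤⟨ +-monoˡ-≤ (#out U) (count-pos (∁? (outside? U)) j∈vertices) ⟩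
      #in U + #out U ≡⟨ #in+#out U ⟩
      suc n          ∎)

  multiparking⇔fits : IsMultiparking (complete n) g ⇔ Fits n [] (seqOf m n g)
  multiparking⇔fits = mk⇔ multiparking⇒fits fits⇒multiparking

length-seqOf : ∀ {m n} → m ≤ n → (g : Fin (suc n) → ℕ∞) → length (seqOf m n g) ≡ m
length-seqOf {m} {n} m≤n g = begin
  length (seqOf m n g)                          ≡⟨ length-map _ (filter (λ j → n ∸ m <? toℕ j) (allFin (suc n))) ⟩
  count (λ j → n ∸ m <? toℕ j) (allFin (suc n)) ≡⟨ count-above-tabulate (n ∸ m) (suc n) 0 id (λ _ → refl) ⟩
  n ∸ (n ∸ m)                                   ≡⟨ m∸[m∸n]≡n m≤n ⟩
  m                                             ∎
  where open ≡-Reasoning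

lemma1p1 : (m n : ℕ) → 1 ≤ m → m ≤ n → (g : Fin (suc n) → ℕ∞) →
    (∀ j → toℕ j ≤ n ∸ m → g j ≡ ∞) →
    (∀ j → n ∸ m < toℕ j → ∃ λ k → g j ≡ fin k) →
    (IsMultiparking (complete n) g ⇔ InPF m n (seqOf m n g))
lemma1p1 m n _ m≤n g g-∞ g-fin = mk⇔
  (λ multiparking → Equivalence.from inPF⇔ (length-seqOf m≤n g , Equivalence.to mp⇔ multiparking))
  (λ inPF → Equivalence.from mp⇔ (proj₂ (Equivalence.to inPF⇔ inPF)))
  where
  mp⇔ = multiparking⇔fits m n g g-∞ g-fin
  inPF⇔ = inPF⇔fits m n (λ j → toNat (g j)) (filter (λ j → n ∸ m <? toℕ j) (allFin (suc n)))
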